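{- Let $\Pi=(\mathcal{P},\mathcal{L})$ be a finite projective plane. Then $\Pi$ is not magic over $\mathbb{R}$; that is, there is no injective function $f:\mathcal{P}\to\mathbb{R}$ such that $\sum_{x\in L} f(x)$ takes the same value for every line $L\in\mathcal{L}$.
   Context: A projective plane $\Pi=(\mathcal{P},\mathcal{L})$ consists of a set of points $\mathcal{P}$ and a set $\mathcal{L}$ of lines (each a subset of $\mathcal{P}$) such that any two distinct points lie on a unique common line, any two distinct lines meet in a unique point, and there exist four points no three of which lie on a common line. It is finite if $\mathcal{P}$ is finite. A function $f:\mathcal{P}\to\mathbb{R}$ whose sums over all lines are equal and which is injective is called magic, and $\Pi$ is magic over $\mathbb{R}$ if such an $f$ exists. -}

module Defs where

open import Data.Nat using (ℕ; zero; suc)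
open import Data.Fin using (Fin; zero; suc)
open import Data.Fin.Subset using (Subset; _∈_; inside; outside)
open import Data.Vec using (lookup)
open import Data.Product using (Σ; ∃; ∃-syntax; _×_; _,_)
open import Relation.Binary.PropositionalEquality using (_≡_; _≢_)
open import Relation.Binary.Structures using (IsTotalOrder)
open import Algebra.Structures using (IsCommutativeRing)
open import Function.Definitions using (Injective)
open import Relation.Nullary using (¬_)
open import Data.Bool using (if_then_else_)

-- A model of the real numbers: a complete (Dedekind / least-upper-bound)
-- ordered field.  All such models are isomorphic to ℝ, so quantifying over
-- them is the same as speaking about ℝ.
record RealNumbers : Set₁ where
  infixl 6 _+_
  infixl 7 _*_
  field
    Carrier : Set
    _+_ _*_ : Carrier → Carrier → Carrier
    -_ : Carrier → Carrier
    0# 1# : Carrier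
    isCommutativeRing : IsCommutativeRing _≡_ _+_ _*_ -_ 0# 1#
    0≢1 : 0# ≢ 1#
    inverse : ∀ x → x ≢ 0# → ∃[ y ] (x * y ≡ 1#)
    _≤_ : Carrier → Carrier → Set
    isTotalOrder : IsTotalOrder _≡_ _≤_
    +-mono-≤ : ∀ {x y} z → x ≤ y → (x + z) ≤ (y + z)
    *-nonneg : ∀ {x y} → 0# ≤ x → 0# ≤ y → 0# ≤ (x * y)
    lub : (S : Carrier → Set) → (∃[ x ] S x) →
          (∃[ u ] (∀ x → S x → x ≤ u)) →
          ∃[ s ] ((∀ x → S x → x ≤ s) ×
                  (∀ u → (∀ x → S x → x ≤ u) → s ≤ u))

-- A finite incidence structure: points are Fin m, lines are given as an
-- injective family  line : Fin k → Subset m  (so 𝓛 is the set of its values).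
module _ {m k : ℕ} (line : Fin k → Subset m) where

  IsProjectivePlane : Set
  IsProjectivePlane =
    Injective _≡_ _≡_ line
    × (∀ (x y : Fin m) → x ≢ y →
         ∃[ l ] ((x ∈ line l × y ∈ line l) ×
                 (∀ l′ → x ∈ line l′ → y ∈ line l′ → l′ ≡ l)))
    × (∀ (l l′ : Fin k) → l ≢ l′ →
         ∃[ x ] ((x ∈ line l × x ∈ line l′) ×
                 (∀ y → y ∈ line l → y ∈ line l′ → y ≡ x)))
    × (∃[ a ] ∃[ b ] ∃[ c ] ∃[ d ]
         ((a ≢ b × a ≢ c × a ≢ d × b ≢ c × b ≢ d × c ≢ d) ×
          NoLine a b c × NoLine a b d × NoLine a c d × NoLine b c d))
    where
    NoLine : Fin m → Fin m → Fin m → Set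
    NoLine a b c = ¬ (∃[ l ] (a ∈ line l × b ∈ line l × c ∈ line l))

module _ (R : RealNumbers) where
  open RealNumbers R

  sumFin : ∀ {n} → (Fin n → Carrier) → Carrier
  sumFin {zero} f = 0#
  sumFin {suc n} f = f zero + sumFin (λ i → f (suc i))

  lineSum : ∀ {m} → (Fin m → Carrier) → Subset m → Carrier
  lineSum f L = sumFin (λ x → if lookup L x then f x else 0#)

  IsMagic : ∀ {m k} → (Fin k → Subset m) → (Fin m → Carrier) → Set
  IsMagic line f =
    Injective _≡_ _≡_ f × (∀ l l′ → lineSum f (line l) ≡ lineSum f (line l′))

  IsMagicPlane : ∀ {m k} → (Fin k → Subset m) → Set
  IsMagicPlane line = ∃[ f ] IsMagic line f

-- Let f be an injective point labelling whose line sums all equal s, write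
-- T for the sum of f over all points, and let deg p be the number of lines
-- through the point p.  Two distinct points lie on exactly one line, so
-- summing the line sums over the pencil of lines through p counts f(p)
-- deg p times and every other point exactly once (the "pencil identity"):
--     deg p · s = deg p · f(p) + (T − f(p)).
-- A double count of incidences shows that deg p = |L| whenever p ∉ L.  Take
-- the four points a, b, c, d in general position and L the line cd.  Then
-- a, b ∉ L, so with κ = |L| the pencil identity gives
--     (κ − 1) · f(a) = κ s − T = (κ − 1) · f(b),
-- and κ − 1 ≠ 0 because L contains the two points c, d.  Hence f(a) = f(b),
-- contradicting injectivity.
module Submission where

open import Defs
open import Data.Nat using (ℕ; zero; suc)
open import Data.Fin using (Fin; zero; suc; _≟_)
open import Data.Fin.Properties using (punchInᵢ≢i)
open import Data.Fin.Subset using (Subset; _∈_)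
open import Data.Vec using (lookup)
open import Data.Vec.Properties using ([]=⇒lookup; lookup⇒[]=)
open import Data.Vec.Functional using (removeAt)
open import Data.Bool using (Bool; true; false; if_then_else_)
open import Data.Product using (∃-syntax; _×_; _,_)
open import Data.Sum using (inj₁; inj₂)
open import Data.Empty using (⊥-elim)
open import Relation.Nullary using (¬_; yes; no)
open import Relation.Nullary.Decidable using (⌊_⌋)
open import Relation.Binary.PropositionalEquality
open import Relation.Binary.Structures using (IsTotalOrder)
open import Algebra.Structures using (IsCommutativeRing)
open import Algebra.Bundles using (CommutativeRing)

module RealFacts (ℝ : RealNumbers) where
  open RealNumbers ℝ
  open IsCommutativeRing isCommutativeRing
    using ( +-identityˡ; +-identityʳ; +-assoc; +-comm; -‿inverseˡ; -‿inverseʳ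
          ; *-identityˡ; *-assoc; *-comm; zeroˡ; zeroʳ; distribʳ )
  open IsTotalOrder isTotalOrder
    using (total; antisym) renaming (refl to ≤-refl; trans to ≤-trans)
  open ≡-Reasoning

  commutativeRing : CommutativeRing _ _
  commutativeRing = record { isCommutativeRing = isCommutativeRing }

  open CommutativeRing commutativeRing using (ring; semiring; +-group)
  open import Algebra.Properties.Ring ring using (-1*x≈-x; -‿involutive)
  open import Algebra.Properties.Group +-group using (∙-cancelʳ)
  open import Algebra.Properties.Semiring.Sum semiring public
    using (sum; sum-syntax; sum-cong-≗; sum-remove; sum-replicate-zero; ∑-comm
          ; *-distribˡ-sum; *-distribʳ-sum)

  -- In an ordered field 1 is positive: otherwise 0 ≤ −1, and then
  -- 0 ≤ (−1)·(−1) = 1 would force 1 = 0.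
  0≤1 : 0# ≤ 1#
  0≤1 with total 0# 1#
  ... | inj₁ 0≤1′ = 0≤1′
  ... | inj₂ 1≤0 = ⊥-elim (0≢1 (sym (antisym 1≤0 0≤square)))
    where
    0≤-1 : 0# ≤ (- 1#)
    0≤-1 = subst₂ _≤_ (-‿inverseʳ 1#) (+-identityˡ (- 1#)) (+-mono-≤ (- 1#) 1≤0)
    0≤square : 0# ≤ 1#
    0≤square = subst (0# ≤_) (trans (-1*x≈-x (- 1#)) (-‿involutive 1#)) (*-nonneg 0≤-1 0≤-1)

  -- 1 + r is nonzero for r ≥ 0; this is what makes |L| − 1 invertible.
  1+nonneg≢0 : ∀ {r} → 0# ≤ r → 1# + r ≢ 0#
  1+nonneg≢0 {r} 0≤r 1+r≡0 = 0≢1 (antisym 0≤1 1≤0)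
    where
    r≡-1 : r ≡ - 1#
    r≡-1 = begin
      r                ≡⟨ sym (+-identityˡ r) ⟩
      0# + r           ≡⟨ cong (_+ r) (sym (-‿inverseˡ 1#)) ⟩
      (- 1# + 1#) + r  ≡⟨ +-assoc (- 1#) 1# r ⟩
      - 1# + (1# + r)  ≡⟨ cong (- 1# +_) 1+r≡0 ⟩
      - 1# + 0#        ≡⟨ +-identityʳ (- 1#) ⟩
      - 1#             ∎
    1≤0 : 1# ≤ 0#
    1≤0 = subst₂ _≤_ (+-identityˡ 1#) (-‿inverseˡ 1#) (+-mono-≤ 1# (subst (0# ≤_) r≡-1 0≤r))

  *-cancelˡ : ∀ {u x y} → u ≢ 0# → u * x ≡ u * y → x ≡ y
  *-cancelˡ {u} {x} {y} u≢0 ux≡uy with inverse u u≢0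
  ... | v , uv≡1 = begin
    x            ≡⟨ sym (*-identityˡ x) ⟩
    1# * x       ≡⟨ cong (_* x) (trans (sym uv≡1) (*-comm u v)) ⟩
    (v * u) * x  ≡⟨ *-assoc v u x ⟩
    v * (u * x)  ≡⟨ cong (v *_) ux≡uy ⟩
    v * (u * y)  ≡⟨ sym (*-assoc v u y) ⟩
    (v * u) * y  ≡⟨ cong (_* y) (trans (*-comm v u) uv≡1) ⟩
    1# * y       ≡⟨ *-identityˡ y ⟩
    y            ∎

  -- If κ = 1 + u, then κ·s = κ·x + D and T = x + D give κ·s = u·x + T:
  -- the pencil identity with the term f(p) moved into the total sum.
  absorb-diagonal : ∀ {κ u s x D T} → κ ≡ 1# + u →
    κ * s ≡ κ * x + D → T ≡ x + D → κ * s ≡ u * x + T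
  absorb-diagonal {κ} {u} {s} {x} {D} {T} κ≡1+u pencil total≡ = begin
    κ * s                  ≡⟨ pencil ⟩
    κ * x + D              ≡⟨ cong (λ c → c * x + D) κ≡1+u ⟩
    (1# + u) * x + D       ≡⟨ cong (_+ D) (distribʳ x 1# u) ⟩
    (1# * x + u * x) + D   ≡⟨ cong (λ y → (y + u * x) + D) (*-identityˡ x) ⟩
    (x + u * x) + D        ≡⟨ cong (_+ D) (+-comm x (u * x)) ⟩
    (u * x + x) + D        ≡⟨ +-assoc (u * x) x D ⟩
    u * x + (x + D)        ≡⟨ cong (u * x +_) (sym total≡) ⟩
    u * x + T              ∎

  affine-injective : ∀ {u T x y} → u ≢ 0# → u * x + T ≡ u * y + T → x ≡ y
  affine-injective {u} {T} {x} {y} u≢0 eq = *-cancelˡ u≢0 (∙-cancelʳ T (u * x) (u * y) eq)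

  sumFin≡sum : ∀ {n} (g : Fin n → Carrier) → sumFin ℝ g ≡ sum g
  sumFin≡sum {zero} g = refl
  sumFin≡sum {suc n} g = cong (g zero +_) (sumFin≡sum (λ i → g (suc i)))

  sum-nonneg : ∀ {n} (g : Fin n → Carrier) → (∀ i → 0# ≤ g i) → 0# ≤ sum g
  sum-nonneg {zero} g g≥0 = ≤-refl
  sum-nonneg {suc n} g g≥0 =
    ≤-trans (subst (0# ≤_) (sym (+-identityˡ _)) (sum-nonneg (λ i → g (suc i)) (λ i → g≥0 (suc i))))
            (+-mono-≤ (sum (λ i → g (suc i))) (g≥0 zero))

  dropAt : ∀ {n} → Fin n → (Fin n → Carrier) → Fin n → Carrier
  dropAt p g i = if ⌊ i ≟ p ⌋ then 0# else g i

  dropAt-self : ∀ {n} (p : Fin n) (g : Fin n → Carrier) → dropAt p g p ≡ 0#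
  dropAt-self p g with p ≟ p
  ... | yes _ = refl
  ... | no p≢p = ⊥-elim (p≢p refl)

  dropAt-other : ∀ {n} {p i : Fin n} (g : Fin n → Carrier) → i ≢ p → dropAt p g i ≡ g i
  dropAt-other {p = p} {i} g i≢p with i ≟ p
  ... | yes i≡p = ⊥-elim (i≢p i≡p)
  ... | no _ = refl

  dropAt-nonneg : ∀ {n} (p : Fin n) {g : Fin n → Carrier} →
    (∀ i → 0# ≤ g i) → ∀ i → 0# ≤ dropAt p g i
  dropAt-nonneg p g≥0 i with i ≟ p
  ... | yes _ = ≤-refl
  ... | no _ = g≥0 i

  dropAt-cong : ∀ {n} (p : Fin n) {g h : Fin n → Carrier} →
    (∀ i → i ≢ p → g i ≡ h i) → sum (dropAt p g) ≡ sum (dropAt p h)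
  dropAt-cong p {g} {h} g≡h = sum-cong-≗ agree
    where
    agree : ∀ i → dropAt p g i ≡ dropAt p h i
    agree i with i ≟ p
    ... | yes _ = refl
    ... | no i≢p = g≡h i i≢p

  sum-extract : ∀ {n} (g : Fin n → Carrier) (p : Fin n) → sum g ≡ g p + sum (dropAt p g)
  sum-extract {suc n} g p = begin
    sum g                                 ≡⟨ sum-remove g ⟩
    g p + sum (removeAt g p)              ≡⟨ cong (g p +_) (sum-cong-≗ off-p) ⟩
    g p + sum (removeAt (dropAt p g) p)   ≡⟨ cong (g p +_) (sym (+-identityˡ _)) ⟩
    g p + (0# + sum (removeAt (dropAt p g) p))
      ≡⟨ cong (λ z → g p + (z + sum (removeAt (dropAt p g) p))) (sym (dropAt-self p g)) ⟩
    g p + (dropAt p g p + sum (removeAt (dropAt p g) p))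
      ≡⟨ cong (g p +_) (sym (sum-remove (dropAt p g))) ⟩
    g p + sum (dropAt p g)                ∎
    where
    off-p : ∀ i → removeAt g p i ≡ removeAt (dropAt p g) p i
    off-p i = sym (dropAt-other g (punchInᵢ≢i p i))

  sum-single : ∀ {n} (g : Fin n → Carrier) (p : Fin n) →
    (∀ i → i ≢ p → g i ≡ 0#) → sum g ≡ g p
  sum-single {n} g p g≡0 = begin
    sum g                                ≡⟨ sum-extract g p ⟩
    g p + sum (dropAt p g)               ≡⟨ cong (g p +_) (dropAt-cong p g≡0) ⟩
    g p + sum (dropAt p (λ _ → 0#))      ≡⟨ cong (g p +_) (sum-cong-≗ (λ i → drop-zero i)) ⟩
    g p + sum {n} (λ _ → 0#)             ≡⟨ cong (g p +_) (sum-replicate-zero n) ⟩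
    g p + 0#                             ≡⟨ +-identityʳ (g p) ⟩
    g p                                  ∎
    where
    drop-zero : ∀ i → dropAt p (λ _ → 0#) i ≡ 0#
    drop-zero i with i ≟ p
    ... | yes _ = refl
    ... | no _ = refl

  ind : Bool → Carrier
  ind b = if b then 1# else 0#

  ind-nonneg : ∀ b → 0# ≤ ind b
  ind-nonneg true = 0≤1
  ind-nonneg false = ≤-refl

  ind-idem : ∀ b → ind b * ind b ≡ ind b
  ind-idem true = *-identityˡ 1#
  ind-idem false = zeroˡ 0#

  if≡ind* : ∀ b y → (if b then y else 0#) ≡ ind b * y
  if≡ind* true y = sym (*-identityˡ y)
  if≡ind* false y = sym (zeroˡ y)

  ind*-absorb : ∀ b {y} → (b ≡ true → y ≡ 1#) → ind b * y ≡ ind b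
  ind*-absorb true y≡1 = trans (*-identityˡ _) (y≡1 refl)
  ind*-absorb false _ = zeroˡ _

  count-unique : ∀ {n} (a b : Fin n → Bool) (j : Fin n) → a j ≡ true → b j ≡ true →
    (∀ i → a i ≡ true → b i ≡ true → i ≡ j) → sum (λ i → ind (a i) * ind (b i)) ≡ 1#
  count-unique a b j aj bj unique =
    trans (sum-single (λ i → ind (a i) * ind (b i)) j vanish) at-j
    where
    vanish : ∀ i → i ≢ j → ind (a i) * ind (b i) ≡ 0#
    vanish i i≢j with a i in ai | b i in bi
    ... | true  | true  = ⊥-elim (i≢j (unique i ai bi))
    ... | true  | false = zeroʳ 1#
    ... | false | _     = zeroˡ _
    at-j : ind (a j) * ind (b j) ≡ 1#
    at-j rewrite aj | bj = *-identityˡ 1#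

  ∑-weighted-comm : ∀ {k m} (w : Fin k → Carrier) (g : Fin k → Fin m → Carrier) →
    sum (λ l → w l * sum (g l)) ≡ sum (λ x → sum (λ l → w l * g l x))
  ∑-weighted-comm w g =
    trans (sum-cong-≗ (λ l → *-distribˡ-sum (w l) (g l))) (∑-comm (λ l x → w l * g l x))

module Incidences (ℝ : RealNumbers) {m k : ℕ} (line : Fin k → Subset m) where
  open RealNumbers ℝ
  open IsCommutativeRing isCommutativeRing using (*-identityˡ; *-assoc; *-comm)
  open RealFacts ℝ
  open ≡-Reasoning

  I : Fin k → Fin m → Carrier
  I l x = ind (lookup (line l) x)

  I-on : ∀ {l x} → x ∈ line l → I l x ≡ 1#
  I-on x∈l rewrite []=⇒lookup x∈l = refl

  deg : Fin m → Carrier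
  deg p = ∑[ l < k ] I l p

  size : Fin k → Carrier
  size l = ∑[ x < m ] I l x

  joining : Fin m → Fin m → Carrier
  joining p x = ∑[ l < k ] (I l p * I l x)

  joining-self : ∀ p → joining p p ≡ deg p
  joining-self p = sum-cong-≗ (λ l → ind-idem (lookup (line l) p))

  pencil-sum : ∀ p (g : Fin m → Carrier) →
    ∑[ l < k ] (I l p * ∑[ x < m ] (I l x * g x)) ≡ ∑[ x < m ] (joining p x * g x)
  pencil-sum p g = trans (∑-weighted-comm (λ l → I l p) (λ l x → I l x * g x))
                         (sum-cong-≗ regroup)
    where
    regroup : ∀ x → ∑[ l < k ] (I l p * (I l x * g x)) ≡ joining p x * g x
    regroup x = trans (sum-cong-≗ (λ l → sym (*-assoc (I l p) (I l x) (g x))))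
                      (sym (*-distribʳ-sum (g x) (λ l → I l p * I l x)))

  lineSum≡ : ∀ (f : Fin m → Carrier) l → lineSum ℝ f (line l) ≡ ∑[ x < m ] (I l x * f x)
  lineSum≡ f l = trans (sumFin≡sum (λ x → if lookup (line l) x then f x else 0#))
                      (sum-cong-≗ (λ x → if≡ind* (lookup (line l) x) (f x)))

  size-two : ∀ {c d L} → c ∈ line L → d ∈ line L → c ≢ d →
    ∃[ r ] (0# ≤ r × size L ≡ 1# + (1# + r))
  size-two {c} {d} {L} c∈L d∈L c≢d = rest , rest≥0 , (begin
    size L                                 ≡⟨ sum-extract (I L) c ⟩
    I L c + sum (dropAt c (I L))           ≡⟨ cong₂ _+_ (I-on c∈L) (sum-extract (dropAt c (I L)) d) ⟩
    1# + (dropAt c (I L) d + rest)         ≡⟨ cong (λ z → 1# + (z + rest)) (trans (dropAt-other (I L) (λ d≡c → c≢d (sym d≡c))) (I-on d∈L)) ⟩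
    1# + (1# + rest)                       ∎)
    where
    rest : Carrier
    rest = sum (dropAt d (dropAt c (I L)))
    rest≥0 : 0# ≤ rest
    rest≥0 = sum-nonneg _ (dropAt-nonneg d (dropAt-nonneg c (λ x → ind-nonneg (lookup (line L) x))))

  module Joins (joins : ∀ (x y : Fin m) → x ≢ y →
                  ∃[ l ] ((x ∈ line l × y ∈ line l) ×
                          (∀ l′ → x ∈ line l′ → y ∈ line l′ → l′ ≡ l))) where

    joining-distinct : ∀ {p x} → p ≢ x → joining p x ≡ 1#
    joining-distinct {p} {x} p≢x with joins p x p≢x
    ... | l , (p∈l , x∈l) , unique =
      count-unique (λ l → lookup (line l) p) (λ l → lookup (line l) x) l
        ([]=⇒lookup p∈l) ([]=⇒lookup x∈l)
        (λ l′ p∈l′ x∈l′ → unique l′ (lookup⇒[]= p (line l′) p∈l′) (lookup⇒[]= x (line l′) x∈l′))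

    pencil-identity : ∀ (f : Fin m → Carrier) {s} → (∀ l → lineSum ℝ f (line l) ≡ s) →
      ∀ p → deg p * s ≡ deg p * f p + sum (dropAt p f)
    pencil-identity f {s} magic p = begin
      deg p * s                                       ≡⟨ *-distribʳ-sum s (λ l → I l p) ⟩
      ∑[ l < k ] (I l p * s)                          ≡⟨ sum-cong-≗ (λ l → cong (I l p *_) (trans (sym (magic l)) (lineSum≡ f l))) ⟩
      ∑[ l < k ] (I l p * ∑[ x < m ] (I l x * f x))   ≡⟨ pencil-sum p f ⟩
      ∑[ x < m ] (joining p x * f x)                  ≡⟨ sum-extract (λ x → joining p x * f x) p ⟩
      joining p p * f p + sum (dropAt p (λ x → joining p x * f x))
        ≡⟨ cong₂ _+_ (cong (_* f p) (joining-self p)) (dropAt-cong p once) ⟩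
      deg p * f p + sum (dropAt p f)                  ∎
      where
      once : ∀ x → x ≢ p → joining p x * f x ≡ f x
      once x x≢p = trans (cong (_* f x) (joining-distinct (λ p≡x → x≢p (sym p≡x)))) (*-identityˡ (f x))

    module Meets (meets : ∀ (l l′ : Fin k) → l ≢ l′ →
                    ∃[ x ] ((x ∈ line l × x ∈ line l′) ×
                            (∀ y → y ∈ line l → y ∈ line l′ → y ≡ x))) where

      meeting-distinct : ∀ {l L} → l ≢ L → ∑[ x < m ] (I l x * I L x) ≡ 1#
      meeting-distinct {l} {L} l≢L with meets l L l≢L
      ... | x , (x∈l , x∈L) , unique =
        count-unique (lookup (line l)) (lookup (line L)) x
          ([]=⇒lookup x∈l) ([]=⇒lookup x∈L)
          (λ y y∈l y∈L → unique y (lookup⇒[]= y (line l) y∈l) (lookup⇒[]= y (line L) y∈L))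

      -- A point off a line L lies on exactly |L| lines: the lines through p
      -- correspond to the points of L they meet.
      deg≡size : ∀ {p L} → ¬ (p ∈ line L) → deg p ≡ size L
      deg≡size {p} {L} p∉L = begin
        deg p                                         ≡⟨ sum-cong-≗ (λ l → sym (ind*-absorb (lookup (line l) p) (meets-L l))) ⟩
        ∑[ l < k ] (I l p * ∑[ x < m ] (I l x * I L x)) ≡⟨ pencil-sum p (I L) ⟩
        ∑[ x < m ] (joining p x * I L x)              ≡⟨ sum-cong-≗ (λ x → trans (*-comm (joining p x) (I L x)) (ind*-absorb (lookup (line L) x) (joined x))) ⟩
        size L                                        ∎
        where
        meets-L : ∀ l → lookup (line l) p ≡ true → ∑[ x < m ] (I l x * I L x) ≡ 1#
        meets-L l p∈l = meeting-distinct (λ { refl → p∉L (lookup⇒[]= p (line l) p∈l) })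
        joined : ∀ x → lookup (line L) x ≡ true → joining p x ≡ 1#
        joined x x∈L = joining-distinct (λ { refl → p∉L (lookup⇒[]= p (line L) x∈L) })

      equal-off-line : ∀ (f : Fin m → Carrier) {s} → (∀ l → lineSum ℝ f (line l) ≡ s) →
        ∀ {L c d} → c ∈ line L → d ∈ line L → c ≢ d →
        ∀ {a b} → ¬ (a ∈ line L) → ¬ (b ∈ line L) → f a ≡ f b
      equal-off-line f {s} magic {L} c∈L d∈L c≢d a∉L b∉L with size-two c∈L d∈L c≢d
      ... | r , r≥0 , size≡ =
        affine-injective (1+nonneg≢0 r≥0) (trans (sym (value a∉L)) (value b∉L))
        where
        value : ∀ {p} → ¬ (p ∈ line L) → size L * s ≡ (1# + r) * f p + sum f
        value {p} p∉L = absorb-diagonal size≡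
          (subst (λ κ → κ * s ≡ κ * f p + sum (dropAt p f)) (deg≡size p∉L)
                 (pencil-identity f magic p))
          (sum-extract f p)

proposition1 : (ℝ : RealNumbers) {m k : ℕ} (line : Fin k → Subset m) →
    IsProjectivePlane line → ¬ IsMagicPlane ℝ line
proposition1 ℝ line
  (_ , joins , meets , a , b , c , d , (a≢b , _ , _ , _ , _ , c≢d) , _ , _ , ¬acd , ¬bcd)
  (f , f-injective , magic)
  with joins c d c≢d
... | L , (c∈L , d∈L) , _ =
  a≢b (f-injective (equal-off-line f (λ l → magic l L) c∈L d∈L c≢d
    (λ a∈L → ¬acd (L , a∈L , c∈L , d∈L)) (λ b∈L → ¬bcd (L , b∈L , c∈L , d∈L))))
  where
  open Incidences ℝ line
  open Joins joins
  open Meets meets
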